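{- Let $P$ be a finite poset with a unique minimal element $\hat{0}$ and let $\sim$ be an equivalence relation on $P$ such that $P/\sim$ is a homogeneous quotient. Suppose that for every equivalence class $X\neq\{\hat{0}\}$ of $P/\sim$, $$\sum_{y\in L(X)}\mu(y)=0,$$ where $L(X)=\{y\in P: y\leq x \text{ for some } x\in X\}$ is the lower order ideal of $P$ generated by $X$ and $\mu$ is the Möbius function of $P$. Then for every equivalence class $X$, $\mu(X)=\sum_{x\in X}\mu(x)$, where $\mu(X)$ denotes the Möbius function of the poset $P/\sim$.
   Context: The one-variable Möbius function of a finite poset $Q$ with minimum $\hat{0}$ is defined recursively by $\sum_{y\leq x}\mu(y)=\delta_{\hat{0},x}$. For an equivalence relation $\sim$ on $P$, the quotient $P/\sim$ is the set of equivalence classes with $X\leq Y$ iff $x\leq y$ in $P$ for some $x\in X$, $y\in Y$. It is a homogeneous quotient if (1) $\{\hat{0}\}$ is an equivalence class, and (2) whenever $X\leq Y$, for every $x\in X$ there is $y\in Y$ with $x\leq y$; in that case $P/\sim$ is a poset with minimum $\{\hat{0}\}$. -}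

module Defs where

open import Level using (0ℓ)
open import Data.Nat using (ℕ; zero; suc)
open import Data.Fin using (Fin; zero; suc; _≟_)
open import Data.Fin.Properties using (any?)
open import Data.Integer using (ℤ; _+_; 0ℤ; 1ℤ)
open import Data.Bool using (if_then_else_)
open import Data.Product using (Σ; ∃; _×_; _,_)
open import Function using (_∘_)
open import Relation.Nullary using (Dec; ¬_)
open import Relation.Nullary.Decidable using (⌊_⌋; _×-dec_)
open import Relation.Binary using (Rel; Decidable)
open import Relation.Binary.PropositionalEquality using (_≡_)

sumFin : ∀ {n} → (Fin n → ℤ) → ℤ
sumFin {zero}  f = 0ℤ
sumFin {suc n} f = f zero + sumFin (f ∘ suc)

sumWhere : ∀ {n} {P : Fin n → Set} → ((y : Fin n) → Dec (P y)) → (Fin n → ℤ) → ℤ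
sumWhere P? f = sumFin (λ y → if ⌊ P? y ⌋ then f y else 0ℤ)

IsMobius : ∀ {k} {_≤_ : Rel (Fin k) 0ℓ} → Decidable _≤_ → Fin k → (Fin k → ℤ) → Set
IsMobius {k} _≤?_ b μ =
  (x : Fin k) → sumWhere (λ y → y ≤? x) μ ≡ (if ⌊ b ≟ x ⌋ then 1ℤ else 0ℤ)

-- The quotient order on classes, where the classes of P = Fin n are encoded
-- as Fin m via the class map q : Fin n → Fin m:
-- X ≤ Y iff x ≤ y for some x ∈ X, y ∈ Y.
QLe : ∀ {n m} → (Fin n → Fin m) → Rel (Fin n) 0ℓ → Rel (Fin m) 0ℓ
QLe q _≤_ X Y = ∃ λ x → ∃ λ y → q x ≡ X × q y ≡ Y × x ≤ y

QLe? : ∀ {n m} (q : Fin n → Fin m) {_≤_ : Rel (Fin n) 0ℓ} → Decidable _≤_ →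
       Decidable (QLe q _≤_)
QLe? q _≤?_ X Y = any? λ x → any? λ y → (q x ≟ X) ×-dec ((q y ≟ Y) ×-dec (x ≤? y))

InL : ∀ {n m} → (Fin n → Fin m) → Rel (Fin n) 0ℓ → Fin m → Fin n → Set
InL q _≤_ X y = ∃ λ x → q x ≡ X × y ≤ x

InL? : ∀ {n m} (q : Fin n → Fin m) {_≤_ : Rel (Fin n) 0ℓ} → Decidable _≤_ →
       (X : Fin m) → (y : Fin n) → Dec (InL q _≤_ X y)
InL? q _≤?_ X y = any? λ x → (q x ≟ X) ×-dec (y ≤? x)

-- Let ν(X) = Σ_{x ∈ X} μ(x).  Summing ν over the classes Y ≤ X regroups the
-- terms into Σ_{y ∈ L(X)} μ(y), because by homogeneity q y ≤ X holds exactly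
-- when y ∈ L(X).  That sum is 0 for X ≠ {0̂} by hypothesis and
-- Σ_{y ≤ 0̂} μ(y) = 1 for X = {0̂}, so ν satisfies the recursion that
-- determines the Möbius function of the finite poset P/∼.  The quotient is
-- antisymmetric because, by homogeneity, a cycle X ≤ Y ≤ X of distinct
-- classes would lift to an infinite strictly ascending chain in P.
module Submission where

open import Defs
open import Level using (0ℓ)
open import Data.Nat using (ℕ; zero; suc)
open import Data.Fin using (Fin; zero; suc; _≟_)
open import Data.Fin.Properties using (punchInᵢ≢i)
open import Data.Fin.Induction using (po-wellFounded)
open import Data.Integer using (ℤ; _+_; 0ℤ; 1ℤ)
import Data.Integer.Properties as ℤ
open import Data.Bool using (Bool; true; false; if_then_else_)
open import Data.Product using (∃; _×_; _,_)
open import Data.Empty using (⊥; ⊥-elim)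
open import Data.Vec.Functional using (removeAt)
open import Function using (_∘_; flip)
open import Function.Bundles using (_⇔_; Equivalence)
open import Induction.WellFounded using (Acc; acc)
open import Relation.Nullary using (Dec; yes; no; ¬_)
open import Relation.Nullary.Decidable using (⌊_⌋)
open import Relation.Binary using
  (Rel; Decidable; Reflexive; Transitive; Antisymmetric; IsPartialOrder; IsDecPartialOrder; IsEquivalence)
import Relation.Binary.Construct.Flip.EqAndOrd as Flip
import Relation.Binary.Construct.NonStrictToStrict as ToStrict
open import Relation.Binary.PropositionalEquality
  using (_≡_; _≢_; _≗_; refl; sym; trans; cong; cong₂; subst; isEquivalence; module ≡-Reasoning)

open import Algebra.Properties.CommutativeMonoid.Sum ℤ.+-0-commutativeMonoid
  using (sum; sum-cong-≗; sum-remove; ∑-comm)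
open import Algebra.Properties.AbelianGroup ℤ.+-0-abelianGroup using (∙-cancelʳ)

open ≡-Reasoning

if-yes : ∀ {A B : Set} (a? : Dec A) {x y : B} → A → (if ⌊ a? ⌋ then x else y) ≡ x
if-yes (yes _) _ = refl
if-yes (no ¬a) a = ⊥-elim (¬a a)

if-no : ∀ {A B : Set} (a? : Dec A) {x y : B} → ¬ A → (if ⌊ a? ⌋ then x else y) ≡ y
if-no (yes a) ¬a = ⊥-elim (¬a a)
if-no (no _) _ = refl

if-same : ∀ {B : Set} (b : Bool) {x : B} → (if b then x else x) ≡ x
if-same true = refl
if-same false = refl

sumFin≡sum : ∀ {n} (f : Fin n → ℤ) → sumFin f ≡ sum f
sumFin≡sum {zero} f = refl
sumFin≡sum {suc n} f = cong (f zero +_) (sumFin≡sum (f ∘ suc))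

sumFin-cong : ∀ {n} {f g : Fin n → ℤ} → f ≗ g → sumFin f ≡ sumFin g
sumFin-cong {zero} f≗g = refl
sumFin-cong {suc n} f≗g = cong₂ _+_ (f≗g zero) (sumFin-cong (f≗g ∘ suc))

sumFin-zero : ∀ {n} → sumFin {n} (λ _ → 0ℤ) ≡ 0ℤ
sumFin-zero {zero} = refl
sumFin-zero {suc n} = trans (ℤ.+-identityˡ _) (sumFin-zero {n})

sumFin-remove : ∀ {n} (f : Fin (suc n) → ℤ) i → sumFin f ≡ f i + sumFin (removeAt f i)
sumFin-remove f i = begin
  sumFin f                     ≡⟨ sumFin≡sum f ⟩
  sum f                        ≡⟨ sum-remove {i = i} f ⟩
  f i + sum (removeAt f i)     ≡⟨ cong (f i +_) (sym (sumFin≡sum (removeAt f i))) ⟩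
  f i + sumFin (removeAt f i)  ∎

sumFin-single : ∀ {n} (f : Fin n → ℤ) i → (∀ j → j ≢ i → f j ≡ 0ℤ) → sumFin f ≡ f i
sumFin-single {suc n} f i vanishes = begin
  sumFin f                     ≡⟨ sumFin-remove f i ⟩
  f i + sumFin (removeAt f i)  ≡⟨ cong (f i +_) (sumFin-cong (λ j → vanishes _ (punchInᵢ≢i i j))) ⟩
  f i + sumFin {n} (λ _ → 0ℤ)  ≡⟨ cong (f i +_) (sumFin-zero {n}) ⟩
  f i + 0ℤ                     ≡⟨ ℤ.+-identityʳ (f i) ⟩
  f i                          ∎

sumFin-cancel-at : ∀ {n} (f g : Fin n → ℤ) i → (∀ j → j ≢ i → f j ≡ g j) →
                   sumFin f ≡ sumFin g → f i ≡ g i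
sumFin-cancel-at {suc n} f g i agree Σf≡Σg = ∙-cancelʳ (sumFin (removeAt f i)) (f i) (g i) (begin
  f i + sumFin (removeAt f i)  ≡⟨ sym (sumFin-remove f i) ⟩
  sumFin f                     ≡⟨ Σf≡Σg ⟩
  sumFin g                     ≡⟨ sumFin-remove g i ⟩
  g i + sumFin (removeAt g i)  ≡⟨ cong (g i +_) (sumFin-cong (λ j → sym (agree _ (punchInᵢ≢i i j)))) ⟩
  g i + sumFin (removeAt f i)  ∎)

sumFin-comm : ∀ {m n} (h : Fin m → Fin n → ℤ) →
              sumFin (λ i → sumFin (h i)) ≡ sumFin (λ j → sumFin (λ i → h i j))
sumFin-comm h = begin
  sumFin (λ i → sumFin (h i))          ≡⟨ sumFin²≡sum² h ⟩
  sum (λ i → sum (h i))                ≡⟨ ∑-comm h ⟩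
  sum (λ j → sum (λ i → h i j))        ≡⟨ sym (sumFin²≡sum² (flip h)) ⟩
  sumFin (λ j → sumFin (λ i → h i j))  ∎
  where
  sumFin²≡sum² : ∀ {m n} (h : Fin m → Fin n → ℤ) → sumFin (λ i → sumFin (h i)) ≡ sum (λ i → sum (h i))
  sumFin²≡sum² h = trans (sumFin≡sum (λ i → sumFin (h i))) (sum-cong-≗ (sumFin≡sum ∘ h))

if-sumFin : ∀ {n} b (f : Fin n → ℤ) → (if b then sumFin f else 0ℤ) ≡ sumFin (λ i → if b then f i else 0ℤ)
if-sumFin true f = refl
if-sumFin {n} false f = sym (sumFin-zero {n})

sumWhere-cong : ∀ {n} {P Q : Fin n → Set} (P? : ∀ y → Dec (P y)) (Q? : ∀ y → Dec (Q y)) (f : Fin n → ℤ) →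
                (∀ y → P y → Q y) → (∀ y → Q y → P y) → sumWhere P? f ≡ sumWhere Q? f
sumWhere-cong P? Q? f P⇒Q Q⇒P = sumFin-cong pointwise
  where
  pointwise : ∀ y → (if ⌊ P? y ⌋ then f y else 0ℤ) ≡ (if ⌊ Q? y ⌋ then f y else 0ℤ)
  pointwise y with P? y
  ... | yes p = sym (if-yes (Q? y) (P⇒Q y p))
  ... | no ¬p = sym (if-no (Q? y) (¬p ∘ Q⇒P y))

sumWhere-fibres : ∀ {n m} (q : Fin n → Fin m) {P : Fin m → Set} (P? : ∀ Y → Dec (P Y)) (f : Fin n → ℤ) →
                  sumWhere P? (λ Y → sumWhere (λ y → q y ≟ Y) f) ≡ sumWhere (P? ∘ q) f
sumWhere-fibres q P? f = begin
  sumFin (λ Y → if ⌊ P? Y ⌋ then sumFin (λ y → if ⌊ q y ≟ Y ⌋ then f y else 0ℤ) else 0ℤ)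
    ≡⟨ sumFin-cong (λ Y → if-sumFin ⌊ P? Y ⌋ (λ y → if ⌊ q y ≟ Y ⌋ then f y else 0ℤ)) ⟩
  sumFin (λ Y → sumFin (λ y → term Y y))   ≡⟨ sumFin-comm term ⟩
  sumFin (λ y → sumFin (λ Y → term Y y))   ≡⟨ sumFin-cong (λ y → sumFin-single (flip term y) (q y) (off-fibre y)) ⟩
  sumFin (λ y → term (q y) y)              ≡⟨ sumFin-cong (λ y → cong (λ z → if ⌊ P? (q y) ⌋ then z else 0ℤ)
                                                                      (if-yes (q y ≟ q y) refl)) ⟩
  sumWhere (P? ∘ q) f                      ∎
  where
  term : Fin _ → Fin _ → ℤ
  term Y y = if ⌊ P? Y ⌋ then (if ⌊ q y ≟ Y ⌋ then f y else 0ℤ) else 0ℤ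
  off-fibre : ∀ y Y → Y ≢ q y → term Y y ≡ 0ℤ
  off-fibre y Y Y≢qy = trans (cong (λ z → if ⌊ P? Y ⌋ then z else 0ℤ) (if-no (q y ≟ Y) (Y≢qy ∘ sym)))
                             (if-same ⌊ P? Y ⌋)

mobius-unique : ∀ {m} {_≤_ : Rel (Fin m) 0ℓ} (_≤?_ : Decidable _≤_) → IsPartialOrder _≡_ _≤_ →
                ∀ {b} {f g : Fin m → ℤ} → IsMobius _≤?_ b f → IsMobius _≤?_ b g → f ≗ g
mobius-unique {_≤_ = _≤_} _≤?_ po {f = f} {g} f-mob g-mob X = go (po-wellFounded po X)
  where
  open IsPartialOrder po using () renaming (refl to ≤-refl)
  below : (Fin _ → ℤ) → Fin _ → Fin _ → ℤ
  below h X Y = if ⌊ Y ≤? X ⌋ then h Y else 0ℤ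
  go : ∀ {X} → Acc (ToStrict._<_ _≡_ _≤_) X → f X ≡ g X
  go {X} (acc smaller) = begin
    f X          ≡⟨ sym (if-yes (X ≤? X) ≤-refl) ⟩
    below f X X  ≡⟨ sumFin-cancel-at (below f X) (below g X) X agree (trans (f-mob X) (sym (g-mob X))) ⟩
    below g X X  ≡⟨ if-yes (X ≤? X) ≤-refl ⟩
    g X          ∎
    where
    agree : ∀ Y → Y ≢ X → below f X Y ≡ below g X Y
    agree Y Y≢X with Y ≤? X
    ... | yes Y≤X = go (smaller (Y≤X , Y≢X))
    ... | no _ = refl

Homogeneous : ∀ {n m} → (Fin n → Fin m) → Rel (Fin n) 0ℓ → Set
Homogeneous q _≤_ = ∀ X Y → QLe q _≤_ X Y → ∀ x → q x ≡ X → ∃ λ y → q y ≡ Y × x ≤ y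

module HomogeneousQuotient {n m} {_≤_ : Rel (Fin n) 0ℓ} (po : IsPartialOrder _≡_ _≤_)
  (q : Fin n → Fin m) (q-surjective : ∀ X → ∃ λ x → q x ≡ X) (homogeneous : Homogeneous q _≤_) where

  open IsPartialOrder po using () renaming (refl to ≤-refl; trans to ≤-trans)

  _⊑_ : Rel (Fin m) 0ℓ
  _⊑_ = QLe q _≤_

  ⊑-refl : Reflexive _⊑_
  ⊑-refl {X} with q-surjective X
  ... | x , qx≡X = x , x , qx≡X , qx≡X , ≤-refl

  ⊑-trans : Transitive _⊑_
  ⊑-trans {X} {Y} {Z} (x , y , qx≡X , qy≡Y , x≤y) Y⊑Z with homogeneous Y Z Y⊑Z y qy≡Y
  ... | z , qz≡Z , y≤z = x , z , qx≡X , qz≡Z , ≤-trans x≤y y≤z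

  no-⊑-cycle : ∀ {x X Y} → Acc (ToStrict._<_ _≡_ (flip _≤_)) x →
               q x ≡ X → X ≢ Y → X ⊑ Y → Y ⊑ X → ⊥
  no-⊑-cycle {x} {X} {Y} (acc larger) qx≡X X≢Y X⊑Y Y⊑X with homogeneous X Y X⊑Y x qx≡X
  ... | y , qy≡Y , x≤y = no-⊑-cycle (larger (x≤y , y≢x)) qy≡Y (X≢Y ∘ sym) Y⊑X X⊑Y
    where
    y≢x : y ≢ x
    y≢x refl = X≢Y (trans (sym qx≡X) qy≡Y)

  ⊑-antisym : Antisymmetric _≡_ _⊑_
  ⊑-antisym {X} {Y} X⊑Y Y⊑X with X ≟ Y | q-surjective X
  ... | yes X≡Y | _ = X≡Y
  ... | no X≢Y | x , qx≡X =
    ⊥-elim (no-⊑-cycle (po-wellFounded (Flip.isPartialOrder po) x) qx≡X X≢Y X⊑Y Y⊑X)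

  ⊑-isPartialOrder : IsPartialOrder _≡_ _⊑_
  ⊑-isPartialOrder = record
    { isPreorder = record
      { isEquivalence = isEquivalence
      ; reflexive = λ { refl → ⊑-refl }
      ; trans = ⊑-trans
      }
    ; antisym = ⊑-antisym
    }

  ⊑-class⇔InL : ∀ X y → q y ⊑ X ⇔ InL q _≤_ X y
  ⊑-class⇔InL X y = record
    { to = λ qy⊑X → homogeneous (q y) X qy⊑X y refl
    ; from = λ { (x , qx≡X , y≤x) → y , x , refl , qx≡X , y≤x }
    ; to-cong = λ { refl → refl }
    ; from-cong = λ { refl → refl }
    }

  module _ (_≤?_ : Decidable _≤_) {bot : Fin n} (bot-alone : ∀ x → q x ≡ q bot → x ≡ bot) where

    L-bot-sum : ∀ {μ} → IsMobius _≤?_ bot μ → sumWhere (InL? q _≤?_ (q bot)) μ ≡ 1ℤ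
    L-bot-sum {μ} μ-mob = begin
      sumWhere (InL? q _≤?_ (q bot)) μ  ≡⟨ sumWhere-cong (InL? q _≤?_ (q bot)) (_≤? bot) μ below-bot in-L-bot ⟩
      sumWhere (_≤? bot) μ              ≡⟨ μ-mob bot ⟩
      (if ⌊ bot ≟ bot ⌋ then 1ℤ else 0ℤ)  ≡⟨ if-yes (bot ≟ bot) refl ⟩
      1ℤ                                ∎
      where
      below-bot : ∀ y → InL q _≤_ (q bot) y → y ≤ bot
      below-bot y (x , qx≡qbot , y≤x) = subst (y ≤_) (bot-alone x qx≡qbot) y≤x
      in-L-bot : ∀ y → y ≤ bot → InL q _≤_ (q bot) y
      in-L-bot y y≤bot = bot , refl , y≤bot

    classSum-isMobius : ∀ {μ} → IsMobius _≤?_ bot μ →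
                        (∀ X → X ≢ q bot → sumWhere (InL? q _≤?_ X) μ ≡ 0ℤ) →
                        IsMobius (QLe? q _≤?_) (q bot) (λ X → sumWhere (λ x → q x ≟ X) μ)
    classSum-isMobius {μ} μ-mob L-sum X = begin
      sumWhere (λ Y → QLe? q _≤?_ Y X) (λ Y → sumWhere (λ x → q x ≟ Y) μ)
        ≡⟨ sumWhere-fibres q (λ Y → QLe? q _≤?_ Y X) μ ⟩
      sumWhere (λ y → QLe? q _≤?_ (q y) X) μ
        ≡⟨ sumWhere-cong _ (InL? q _≤?_ X) μ (Equivalence.to ∘ ⊑-class⇔InL X) (Equivalence.from ∘ ⊑-class⇔InL X) ⟩
      sumWhere (InL? q _≤?_ X) μ
        ≡⟨ L-sum′ X ⟩
      (if ⌊ q bot ≟ X ⌋ then 1ℤ else 0ℤ) ∎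
      where
      L-sum′ : ∀ X → sumWhere (InL? q _≤?_ X) μ ≡ (if ⌊ q bot ≟ X ⌋ then 1ℤ else 0ℤ)
      L-sum′ X with q bot ≟ X
      ... | yes refl = L-bot-sum μ-mob
      ... | no qbot≢X = L-sum X (qbot≢X ∘ sym)

lemma2p4 : (n m : ℕ) (_≤_ : Rel (Fin n) 0ℓ) (_≤?_ : Decidable _≤_)
    → IsDecPartialOrder _≡_ _≤_
    → (bot : Fin n) → (∀ x → bot ≤ x)
    → (_∼_ : Rel (Fin n) 0ℓ) → IsEquivalence _∼_
    → (q : Fin n → Fin m)
    → (∀ X → ∃ λ x → q x ≡ X)
    → (∀ x y → (q x ≡ q y) ⇔ (x ∼ y))
    → (∀ x → x ∼ bot → x ≡ bot)
    → (∀ X Y → QLe q _≤_ X Y → ∀ x → q x ≡ X → ∃ λ y → q y ≡ Y × x ≤ y)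
    → (μ : Fin n → ℤ) → IsMobius _≤?_ bot μ
    → (μQ : Fin m → ℤ) → IsMobius (QLe? q _≤?_) (q bot) μQ
    → (∀ X → X ≢ q bot → sumWhere (InL? q _≤?_ X) μ ≡ 0ℤ)
    → ∀ X → μQ X ≡ sumWhere (λ x → q x ≟ X) μ
lemma2p4 _ _ _≤_ _≤?_ dpo bot _ _ _ q q-surjective q≡⇔∼ bot-class homogeneous _ μ-mob _ μQ-mob L-sum =
  mobius-unique (QLe? q _≤?_) ⊑-isPartialOrder μQ-mob (classSum-isMobius _≤?_ bot-alone μ-mob L-sum)
  where
  open HomogeneousQuotient (IsDecPartialOrder.isPartialOrder dpo) q q-surjective homogeneous
  bot-alone : ∀ x → q x ≡ q bot → x ≡ bot
  bot-alone x = bot-class x ∘ Equivalence.to (q≡⇔∼ x bot)
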